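{- Suppose that $\sqrt{p_m} - \sqrt{p_{m-1}} < 1$ holds for every integer $m \geq 2$. Then for every integer $n \geq 8$ the open interval $(n, 2n-2)$ contains at least two prime numbers.
   Context: $p_m$ denotes the $m$-th prime number ($p_1 = 2$). -}

module Defs where

open import Data.Nat using (ℕ; zero; suc; _+_; _*_; _∸_; _≤_; _<_)
open import Data.Nat.Primality using (Prime; prime?)
open import Data.Bool using (if_then_else_)
open import Data.Sum using (_⊎_)
open import Relation.Nullary using (does)

π : ℕ → ℕ
π zero    = 0
π (suc n) = if does (prime? (suc n)) then suc (π n) else π n

-- p is the m-th prime p_m (p_1 = 2): p is prime and exactly m primes are ≤ p.
IsNthPrime : ℕ → ℕ → Set
IsNthPrime m p = Prime p × π p ≡ m
  where
  open import Data.Product using (_×_)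
  open import Relation.Binary.PropositionalEquality using (_≡_)

-- SqrtDiffLtOne a b  encodes  √a − √b < 1  for natural numbers a, b,
-- without real numbers:  √a < √b + 1  ⟺  a < b + 1 + 2√b
--   ⟺  a ≤ b + 1,  or  (a − b − 1)² < 4b  (both sides nonnegative).
SqrtDiffLtOne : ℕ → ℕ → Set
SqrtDiffLtOne a b = a ≤ suc b ⊎ (a ∸ suc b) * (a ∸ suc b) < 4 * b

module Submission where

-- Squared, the hypothesis says that the number of integers strictly
-- between consecutive primes q < p is less than 2√q.  For n ≥ 31 take the
-- largest prime q ≤ n and the next two primes p < r; then n < p, and with
-- c the larger of the two gaps we get p ≤ n + 1 + c, r ≤ n + 2 + 2c and
-- c² < 4p ≤ 4(n + 1 + c).  If n ≤ 2c + 4 this gives c² < 12c + 20, so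
-- c ≤ 13 and n ≤ 30; hence for n ≥ 31 we have 2c + 5 ≤ n and
-- r ≤ n + 2 + 2c ≤ 2n − 3.  The cases 8 ≤ n ≤ 30 are settled by seven
-- explicit pairs of primes.

open import Defs
open import Data.Nat
  using (ℕ; suc; _+_; _*_; _∸_; _⊔_; _!; _≤_; _<_; _≤′_; ≤′-refl; ≤′-step; z≤n; s≤s;
         _<?_; _≤?_; >-nonZero⁻¹)
open import Data.Nat.Properties
open import Data.Nat.Divisibility using (_∣_; divides; m∣m*n; ∣-trans; m≤n⇒m!∣n!; ∣m+n∣m⇒∣n; ∣1⇒≡1)
open import Data.Nat.Primality using (Prime; prime?; prime[2]; ¬prime[1]; prime⇒nonZero)
open import Data.Nat.Primality.Factorisation using (factorise)
open import Data.Nat.ListAction using (product)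
open import Data.Nat.Tactic.RingSolver using (solve-∀)
open import Data.Product using (Σ; _×_; ∃; ∃-syntax; _,_)
open import Data.Sum using (_⊎_; inj₁; inj₂)
open import Data.List using ([]; _∷_)
open import Data.List.Relation.Unary.All using (_∷_)
open import Data.Empty using (⊥-elim)
open import Relation.Nullary using (¬_; yes; no; contradiction)
open import Relation.Nullary.Decidable using (True; toWitness)
open import Relation.Unary using (Decidable)
open import Relation.Binary.PropositionalEquality using (_≡_; refl; sym; trans; cong; subst)

Gap : (ℕ → Set) → ℕ → ℕ → Set
Gap P a b = ∀ r → a < r → r < b → ¬ P r

NextAbove : (ℕ → Set) → ℕ → ℕ → Set
NextAbove P q p = q < p × P p × Gap P q p

module Search {P : ℕ → Set} (P? : Decidable P) where

  gap-empty : ∀ a → Gap P a (suc a)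
  gap-empty a r a<r r≤a _ = <⇒≱ a<r (≤-pred r≤a)

  gap-extend : ∀ {a b} → Gap P a b → ¬ P b → Gap P a (suc b)
  gap-extend gap ¬Pb r a<r r<1+b with m≤n⇒m<n∨m≡n (≤-pred r<1+b)
  ... | inj₁ r<b  = gap r a<r r<b
  ... | inj₂ refl = ¬Pb

  scan : ∀ {q b} → q ≤′ b → ∃ (NextAbove P q) ⊎ Gap P q (suc b)
  scan {q} ≤′-refl = inj₂ (gap-empty q)
  scan (≤′-step {b} q≤′b) with scan q≤′b
  ... | inj₁ found = inj₁ found
  ... | inj₂ gap with P? (suc b)
  ...   | yes P[1+b] = inj₁ (suc b , s≤s (≤′⇒≤ q≤′b) , P[1+b] , gap)
  ...   | no ¬P[1+b] = inj₂ (gap-extend gap ¬P[1+b])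

  leastAbove : ∀ {q p} → q < p → P p → ∃ (NextAbove P q)
  leastAbove {p = p} q<p Pp with scan (≤⇒≤′ (<⇒≤ q<p))
  ... | inj₁ found = found
  ... | inj₂ gap   = ⊥-elim (gap p q<p ≤-refl Pp)

  greatestUpTo : ∀ {b n} → b ≤′ n → P b → ∃[ q ] q ≤ n × P q × Gap P q (suc n)
  greatestUpTo {b} ≤′-refl Pb = b , ≤-refl , Pb , gap-empty b
  greatestUpTo (≤′-step {n} b≤′n) Pb with P? (suc n)
  ... | yes P[1+n] = suc n , ≤-refl , P[1+n] , gap-empty (suc n)
  ... | no ¬P[1+n] with greatestUpTo b≤′n Pb
  ...   | q , q≤n , Pq , gap = q , m≤n⇒m≤1+n q≤n , Pq , gap-extend gap ¬P[1+n]

open Search prime? using (leastAbove; greatestUpTo)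

primeDivisor : ∀ n → 1 < n → ∃[ p ] Prime p × p ∣ n
primeDivisor n@(suc _) 1<n with factorise n
... | record { factors = [] ; isFactorisation = n≡1 } = ⊥-elim (<⇒≢ 1<n (sym n≡1))
... | record { factors = p ∷ ps ; isFactorisation = n≡p*ps ; factorsPrime = p-prime ∷ _ } =
  p , p-prime , divides (product ps) (trans n≡p*ps (*-comm p (product ps)))

∣-factorial : ∀ {d q} → 0 < d → d ≤ q → d ∣ q !
∣-factorial {suc k} _ d≤q = ∣-trans (m∣m*n (k !)) (m≤n⇒m!∣n! d≤q)

-- Euclid: a prime divisor of q! + 1 cannot be ≤ q.
primeAbove : ∀ q → ∃[ p ] q < p × Prime p
primeAbove q with primeDivisor (q ! + 1) (+-monoˡ-≤ 1 (1≤n! q))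
... | p , p-prime , p∣q!+1 with q <? p
...   | yes q<p = p , q<p , p-prime
...   | no  q≮p = contradiction (subst Prime (∣1⇒≡1 p∣1) p-prime) ¬prime[1]
  where
  p∣1 : p ∣ 1
  p∣1 = ∣m+n∣m⇒∣n p∣q!+1 (∣-factorial (>-nonZero⁻¹ p {{prime⇒nonZero p-prime}}) (≮⇒≥ q≮p))

nextPrime : ∀ q → ∃ (NextAbove Prime q)
nextPrime q with primeAbove q
... | p , q<p , p-prime = leastAbove q<p p-prime

lastPrimeUpTo : ∀ n → 2 ≤ n → ∃[ q ] q ≤ n × Prime q × Gap Prime q (suc n)
lastPrimeUpTo n 2≤n = greatestUpTo (≤⇒≤′ 2≤n) prime[2]

π-prime : ∀ {x} → Prime (suc x) → π (suc x) ≡ suc (π x)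
π-prime {x} x+1-prime with prime? (suc x)
... | yes _ = refl
... | no ¬prime = contradiction x+1-prime ¬prime

π-nonprime : ∀ {x} → ¬ Prime (suc x) → π (suc x) ≡ π x
π-nonprime {x} ¬prime with prime? (suc x)
... | yes x+1-prime = contradiction x+1-prime ¬prime
... | no _ = refl

π-flat : ∀ {a b} → a ≤′ b → Gap Prime a (suc b) → π b ≡ π a
π-flat ≤′-refl _ = refl
π-flat (≤′-step {b} a≤′b) gap =
  trans (π-nonprime (gap (suc b) (s≤s (≤′⇒≤ a≤′b)) ≤-refl))
        (π-flat a≤′b (λ r a<r r≤b → gap r a<r (m≤n⇒m≤1+n r≤b)))

π-next : ∀ {q p} → NextAbove Prime q p → π p ≡ suc (π q)
π-next {p = suc p} (q<p , p-prime , gap) =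
  trans (π-prime p-prime) (cong suc (π-flat (≤⇒≤′ (≤-pred q<p)) gap))

π-positive : ∀ {q} → Prime q → 1 ≤ π q
π-positive {suc x} q-prime = subst (1 ≤_) (sym (π-prime q-prime)) (s≤s z≤n)

SqrtGapHypothesis : Set
SqrtGapHypothesis =
  ∀ (m p q : ℕ) → 2 ≤ m → IsNthPrime m p → IsNthPrime (m ∸ 1) q → SqrtDiffLtOne p q

sqrtDiff⇒gap² : ∀ {p q} → 1 ≤ q → SqrtDiffLtOne p q → (p ∸ suc q) * (p ∸ suc q) < 4 * q
sqrtDiff⇒gap² {q = q} 1≤q (inj₁ p≤1+q) rewrite m≤n⇒m∸n≡0 p≤1+q = ≤-trans 1≤q (m≤m+n q (3 * q))
sqrtDiff⇒gap² 1≤q (inj₂ gap²<4q) = gap²<4q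

primeGap² : SqrtGapHypothesis → ∀ {q p} → Prime q → NextAbove Prime q p
          → (p ∸ suc q) * (p ∸ suc q) < 4 * q
primeGap² H {q} {p} q-prime q→p@(_ , p-prime , _) =
  sqrtDiff⇒gap² (>-nonZero⁻¹ q {{prime⇒nonZero q-prime}})
    (H (suc (π q)) p q (s≤s (π-positive q-prime)) (p-prime , π-next q→p) (q-prime , refl))

square-dominates : ∀ {c} → 14 ≤ c → 12 * c + 20 < c * c
square-dominates {c} 14≤c = begin-strict
  12 * c + 20     <⟨ +-monoʳ-< (12 * c) (m≤m+n 21 7) ⟩
  12 * c + 28     ≤⟨ +-monoʳ-≤ (12 * c) (*-monoʳ-≤ 2 14≤c) ⟩
  12 * c + 2 * c  ≡⟨ twelve+two c ⟩
  14 * c          ≤⟨ *-monoˡ-≤ c 14≤c ⟩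
  c * c           ∎
  where
  open ≤-Reasoning
  twelve+two : ∀ c → 12 * c + 2 * c ≡ 14 * c
  twelve+two = solve-∀

-- If c² < 4(n + 1 + c) and n ≥ 31, then 2c + 4 < n: otherwise
-- c² < 4(3c + 5) = 12c + 20 forces c ≤ 13 and hence n ≤ 2c + 4 ≤ 30.
excessBound : ∀ n c → 31 ≤ n → c * c < 4 * (suc n + c) → 2 * c + 4 < n
excessBound n c 31≤n c²<4[n+1+c] with 2 * c + 4 <? n
... | yes fits = fits
... | no ¬fits = contradiction 31≤n (≤⇒≯ n≤30)
  where
  n≤2c+4 : n ≤ 2 * c + 4
  n≤2c+4 = ≮⇒≥ ¬fits
  expand : ∀ c → 4 * (suc (2 * c + 4) + c) ≡ 12 * c + 20
  expand = solve-∀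
  c²<12c+20 : c * c < 12 * c + 20
  c²<12c+20 = <-≤-trans c²<4[n+1+c]
    (subst (4 * (suc n + c) ≤_) (expand c) (*-monoʳ-≤ 4 (+-monoˡ-≤ c (s≤s n≤2c+4))))
  c≤13 : c ≤ 13
  c≤13 = ≤-pred (≰⇒> (λ 14≤c → <-asym c²<12c+20 (square-dominates 14≤c)))
  n≤30 : n ≤ 30
  n≤30 = ≤-trans n≤2c+4 (+-monoˡ-≤ 4 (*-monoʳ-≤ 2 c≤13))

⊔-square< : ∀ a b {X} → a * a < X → b * b < X → (a ⊔ b) * (a ⊔ b) < X
⊔-square< a b a²<X b²<X with ⊔-sel a b
... | inj₁ a⊔b≡a rewrite a⊔b≡a = a²<X
... | inj₂ a⊔b≡b rewrite a⊔b≡b = b²<X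

twoGapsFit : ∀ {n q p r} → 31 ≤ n → q ≤ n → q < p → p < r
           → (p ∸ suc q) * (p ∸ suc q) < 4 * q
           → (r ∸ suc p) * (r ∸ suc p) < 4 * p
           → r < 2 * n ∸ 2
twoGapsFit {n} {q} {p} {r} 31≤n q≤n q<p p<r a²<4q b²<4p =
  m+n≤o⇒m≤o∸n (suc r) (begin
    suc r + 2                      ≤⟨ +-monoˡ-≤ 2 (s≤s r≤n+2+2c) ⟩
    suc (suc (suc n + c) + c) + 2  ≡⟨ regroup n c ⟩
    n + suc (2 * c + 4)            ≤⟨ +-monoʳ-≤ n (excessBound n c 31≤n c²<4[n+1+c]) ⟩
    n + n                          ≡⟨ cong (n +_) (+-identityʳ n) ⟨
    2 * n                          ∎)
  where
  open ≤-Reasoning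
  a = p ∸ suc q
  b = r ∸ suc p
  c = a ⊔ b
  p≤n+1+c : p ≤ suc n + c
  p≤n+1+c = subst (_≤ suc n + c) (m+[n∸m]≡n q<p) (+-mono-≤ (s≤s q≤n) (m≤m⊔n a b))
  r≤n+2+2c : r ≤ suc (suc n + c) + c
  r≤n+2+2c = subst (_≤ suc (suc n + c) + c) (m+[n∸m]≡n p<r) (+-mono-≤ (s≤s p≤n+1+c) (m≤n⊔m a b))
  c²<4[n+1+c] : c * c < 4 * (suc n + c)
  c²<4[n+1+c] = <-≤-trans (⊔-square< a b (<-≤-trans a²<4q (*-monoʳ-≤ 4 (<⇒≤ q<p))) b²<4p)
                          (*-monoʳ-≤ 4 p≤n+1+c)
  regroup : ∀ n c → suc (suc (suc n + c) + c) + 2 ≡ n + suc (2 * c + 4)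
  regroup = solve-∀

TwoPrimesIn : ℕ → Set
TwoPrimesIn n = Σ ℕ (λ p → Σ ℕ (λ q → p < q × n < p × q < 2 * n ∸ 2 × Prime p × Prime q))

byPair : ∀ {n} lo p q {_ : True (p <? q)} {_ : True (prime? p)} {_ : True (prime? q)}
           {_ : True (suc q + 2 ≤? 2 * lo)}
       → lo ≤ n → n < p → TwoPrimesIn n
byPair lo p q {p<q} {p-prime} {q-prime} {q+3≤2lo} lo≤n n<p =
  p , q , toWitness p<q , n<p ,
  m+n≤o⇒m≤o∸n (suc q) (≤-trans (toWitness q+3≤2lo) (*-monoʳ-≤ 2 lo≤n)) ,
  toWitness p-prime , toWitness q-prime

smallCases : ∀ n → 8 ≤ n → n < 31 → TwoPrimesIn n
smallCases n 8≤n n<31 with n <? 11 | n <? 13 | n <? 17 | n <? 19 | n <? 23 | n <? 29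
... | yes n<11 | _        | _        | _        | _        | _        = byPair 8 11 13 8≤n n<11
... | no n≮11  | yes n<13 | _        | _        | _        | _        = byPair 11 13 17 (≮⇒≥ n≮11) n<13
... | no _     | no n≮13  | yes n<17 | _        | _        | _        = byPair 13 17 19 (≮⇒≥ n≮13) n<17
... | no _     | no _     | no n≮17  | yes n<19 | _        | _        = byPair 17 19 23 (≮⇒≥ n≮17) n<19
... | no _     | no _     | no _     | no n≮19  | yes n<23 | _        = byPair 19 23 29 (≮⇒≥ n≮19) n<23
... | no _     | no _     | no _     | no _     | no n≮23  | yes n<29 = byPair 23 29 31 (≮⇒≥ n≮23) n<29
... | no _     | no _     | no _     | no _     | no _     | no n≮29  = byPair 29 31 37 (≮⇒≥ n≮29) n<31

largeCase : SqrtGapHypothesis → ∀ n → 31 ≤ n → TwoPrimesIn n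
largeCase H n 31≤n with lastPrimeUpTo n (≤-trans (m≤m+n 2 29) 31≤n)
... | q , q≤n , q-prime , noPrimeUpTo-n with nextPrime q
... | p , q→p@(q<p , p-prime , _) with nextPrime p
... | r , p→r@(p<r , r-prime , _) =
  p , r , p<r , n<p ,
  twoGapsFit 31≤n q≤n q<p p<r (primeGap² H q-prime q→p) (primeGap² H p-prime p→r) ,
  p-prime , r-prime
  where
  n<p : n < p
  n<p = ≰⇒> (λ p≤n → noPrimeUpTo-n p q<p (s≤s p≤n) p-prime)

corollary1 : (∀ (m p q : ℕ) → 2 ≤ m → IsNthPrime m p → IsNthPrime (m ∸ 1) q → SqrtDiffLtOne p q)
    → ∀ (n : ℕ) → 8 ≤ n
    → Σ ℕ (λ p → Σ ℕ (λ q → p < q × n < p × q < 2 * n ∸ 2 × Prime p × Prime q))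
corollary1 H n 8≤n with n <? 31
... | yes n<31 = smallCases n 8≤n n<31
... | no n≮31  = largeCase H n (≮⇒≥ n≮31)
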